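{- Let $k \geq 1$ and $n \geq 2k+1$. Then the biclique-chromatic number of the power of a path $P_n^k$ is $2$.
   Context: For $k \geq 1$, the power of a path $P_n^k$ is the simple graph with vertex set $\{v_0,\dots,v_{n-1}\}$ in which $v_i v_j$ is an edge if and only if $0<|i-j| \leq k$. A biclique of a graph is a maximal (under inclusion) set of vertices inducing a complete bipartite subgraph with at least one edge. A biclique-colouring is an assignment of colours to the vertices such that no biclique is monochromatic; the biclique-chromatic number $\kappa_B(G)$ is the least $c$ such that $G$ has a biclique-colouring using at most $c$ colours. -}

module Defs where

open import Data.Nat using (ℕ; _<_; _≤_; ∣_-_∣)
open import Data.Fin using (Fin; toℕ)
open import Data.Fin.Subset using (Subset; _∈_; _∉_; _⊆_)
open import Data.Sum using (_⊎_)
open import Data.Product using (Σ; _×_; ∃; ∃-syntax)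
open import Relation.Nullary using (¬_)
open import Relation.Binary.PropositionalEquality using (_≢_)

Graph : ℕ → Set₁
Graph n = Fin n → Fin n → Set

PathPower : (n k : ℕ) → Graph n
PathPower n k i j = (0 < ∣ toℕ i - toℕ j ∣) × (∣ toℕ i - toℕ j ∣ ≤ k)

InducesBiclique : ∀ {n} → Graph n → Subset n → Set
InducesBiclique {n} G S =
  Σ (Subset n) λ X → Σ (Subset n) λ Y →
      (∀ v → v ∈ S → (v ∈ X) ⊎ (v ∈ Y))
    × (X ⊆ S) × (Y ⊆ S)
    × (∀ v → v ∈ X → v ∉ Y)
    × (∃[ x ] x ∈ X) × (∃[ y ] y ∈ Y)
    × (∀ x y → x ∈ X → y ∈ Y → G x y)
    × (∀ u v → u ∈ X → v ∈ X → ¬ G u v)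
    × (∀ u v → u ∈ Y → v ∈ Y → ¬ G u v)

IsBiclique : ∀ {n} → Graph n → Subset n → Set
IsBiclique {n} G S =
  InducesBiclique G S × (∀ (T : Subset n) → S ⊆ T → InducesBiclique G T → T ⊆ S)

IsBicliqueColouring : ∀ {n} → Graph n → (c : ℕ) → (Fin n → Fin c) → Set
IsBicliqueColouring G c col =
  ∀ S → IsBiclique G S → ∃[ u ] ∃[ v ] (u ∈ S × v ∈ S × col u ≢ col v)

BicliqueColourable : ∀ {n} → Graph n → ℕ → Set
BicliqueColourable {n} G c = Σ (Fin n → Fin c) λ col → IsBicliqueColouring G c col

BicliqueChromaticNumber≡ : ∀ {n} → Graph n → ℕ → Set
BicliqueChromaticNumber≡ G c =
  BicliqueColourable G c × (∀ c' → c' < c → ¬ BicliqueColourable G c')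

module Submission where

-- Colour vertex i by the parity of ⌊i/k⌋, so that the colour classes are alternating blocks
-- of k consecutive vertices. A biclique with a part of size at least two contains an induced
-- path u – w – v; edges span at most k while the non-edge u < v spans more than k, so one
-- of the two edges joins consecutive blocks and the biclique sees both colours. No biclique
-- is a single edge ij (i < j): the vertex i + k + 1, or j - k - 1 if that one lies beyond
-- v_{n-1} (which n ≥ 2k + 1 allows), is adjacent to exactly one endpoint and extends it.
-- Conversely the induced path v_0 – v_k – v_{k+1} spans a biclique, so one colour is not enough.

open import Defs
open import Data.Nat
open import Data.Nat.Properties
open import Data.Nat.DivMod using (_/_; /-monoˡ-≤; +-distrib-/-∣ʳ; n/n≡1)
open import Data.Nat.Divisibility using (∣-refl)
open import Data.Fin as Fin using (Fin; toℕ; fromℕ<)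
open import Data.Fin.Properties using (any?; toℕ-injective; toℕ-fromℕ<; toℕ<n)
open import Data.Fin.Subset using (Subset; _∈_; _∉_; _⊆_; _∪_; ⁅_⁆)
open import Data.Fin.Subset.Properties using (_∈?_; x∈⁅x⁆; x∈⁅y⁆⇒x≡y; p⊆p∪q; q⊆p∪q; x∈p∪q⁻)
open import Data.Product using (_×_; _,_; ∃-syntax; map₂)
open import Data.Sum as Sum using (_⊎_; inj₁; inj₂)
open import Data.Empty using (⊥-elim)
open import Function.Base using (_∘_; _∘₂_; _on_; case_of_)
open import Function.Definitions using (Injective)
open import Relation.Nullary using (¬_; yes; no)
open import Relation.Nullary.Decidable using (_×-dec_; ¬?)
open import Relation.Binary.Definitions using (Symmetric; Irreflexive; tri<; tri≈; tri>)
open import Relation.Binary.PropositionalEquality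

-- c ≢ y excludes the degenerate witness c = y.
Distinguishes : ∀ {A : Set} → (A → A → Set) → A → A → A → Set
Distinguishes R c x y = R c x × ¬ R c y × c ≢ y

EdgesDistinguished : ∀ {A : Set} → (A → A → Set) → Set
EdgesDistinguished R = ∀ {x y} → R x y → ∃[ c ] (Distinguishes R c x y ⊎ Distinguishes R c y x)

NoMonochromaticInducedP₃ : ∀ {A C : Set} → (A → A → Set) → (A → C) → Set
NoMonochromaticInducedP₃ R col =
  ∀ {x y z} → R x y → R y z → ¬ R x z → x ≢ z → col x ≢ col y ⊎ col z ≢ col y

NoMonochromaticInducedP₃-on : ∀ {A B C : Set} {R : B → B → Set} {col : B → C} {f : A → B} →
  Injective _≡_ _≡_ f → NoMonochromaticInducedP₃ R col → NoMonochromaticInducedP₃ (R on f) (col ∘ f)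
NoMonochromaticInducedP₃-on f-injective noMono x~y y~z x≁z x≢z =
  noMono x~y y~z x≁z (λ fx≡fz → x≢z (f-injective fx≡fz))

Distinguishes-on : ∀ {A B : Set} {R : B → B → Set} {f : A → B} {c x y} →
  Injective _≡_ _≡_ f → Distinguishes R (f c) (f x) (f y) → Distinguishes (R on f) c x y
Distinguishes-on f-injective (c~x , c≁y , fc≢fy) = c~x , c≁y , fc≢fy ∘ cong _

-- The body of InducesBiclique: InducesBiclique G S is Σ X Σ Y (BicliqueParts G S X Y).
BicliqueParts : ∀ {n} → Graph n → Subset n → Subset n → Subset n → Set
BicliqueParts G S X Y =
    (∀ v → v ∈ S → (v ∈ X) ⊎ (v ∈ Y))
  × (X ⊆ S) × (Y ⊆ S)
  × (∀ v → v ∈ X → v ∉ Y)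
  × (∃[ x ] x ∈ X) × (∃[ y ] y ∈ Y)
  × (∀ x y → x ∈ X → y ∈ Y → G x y)
  × (∀ u v → u ∈ X → v ∈ X → ¬ G u v)
  × (∀ u v → u ∈ Y → v ∈ Y → ¬ G u v)

Bichromatic : ∀ {n c} → (Fin n → Fin c) → Subset n → Set
Bichromatic col S = ∃[ u ] ∃[ v ] (u ∈ S × v ∈ S × col u ≢ col v)

module _ {n : ℕ} where

  ∈∪⁅⁆⁻ : ∀ {v c : Fin n} (A : Subset n) → v ∈ A ∪ ⁅ c ⁆ → v ∈ A ⊎ v ≡ c
  ∈∪⁅⁆⁻ {c = c} A = Sum.map₂ (x∈⁅y⁆⇒x≡y c) ∘ x∈p∪q⁻ A ⁅ c ⁆

  ∈⁅⁆∪⁅⁆⁻ : ∀ {v x z : Fin n} → v ∈ ⁅ x ⁆ ∪ ⁅ z ⁆ → v ≡ x ⊎ v ≡ z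
  ∈⁅⁆∪⁅⁆⁻ {x = x} = Sum.map₁ (x∈⁅y⁆⇒x≡y x) ∘ ∈∪⁅⁆⁻ ⁅ x ⁆

  otherMember⊎⊆⁅⁆ : ∀ (X : Subset n) x → (∃[ x′ ] x′ ∈ X × x′ ≢ x) ⊎ X ⊆ ⁅ x ⁆
  otherMember⊎⊆⁅⁆ X x with any? (λ v → (v ∈? X) ×-dec ¬? (v Fin.≟ x))
  ... | yes other = inj₁ other
  ... | no noOther = inj₂ only-x
    where
    only-x : X ⊆ ⁅ x ⁆
    only-x {v} v∈X with v Fin.≟ x
    ... | yes refl = x∈⁅x⁆ x
    ... | no v≢x   = ⊥-elim (noOther (v , v∈X , v≢x))

module _ {n : ℕ} {G : Graph n} (G-sym : Symmetric G) where

  BicliqueParts-swap : ∀ {S X Y} → BicliqueParts G S X Y → BicliqueParts G S Y X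
  BicliqueParts-swap (cover , X⊆S , Y⊆S , disjoint , inX , inY , cross , indepX , indepY) =
    Sum.swap ∘₂ cover , Y⊆S , X⊆S , (λ v v∈Y v∈X → disjoint v v∈X v∈Y) , inY , inX ,
    (λ y x y∈Y x∈X → G-sym (cross x y x∈X y∈Y)) , indepY , indepX

  inducedP₃⇒bichromatic : ∀ {c} {col : Fin n → Fin c} {S X Y x x′ y} →
    NoMonochromaticInducedP₃ G col → BicliqueParts G S X Y →
    x ∈ X → x′ ∈ X → x ≢ x′ → y ∈ Y → Bichromatic col S
  inducedP₃⇒bichromatic {x = x} {x′} {y} noMono (_ , X⊆S , Y⊆S , _ , _ , _ , cross , indepX , _)
    x∈X x′∈X x≢x′ y∈Y
    with noMono (cross x y x∈X y∈Y) (G-sym (cross x′ y x′∈X y∈Y)) (indepX x x′ x∈X x′∈X) x≢x′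
  ... | inj₁ col-x≢col-y  = x , y , X⊆S x∈X , Y⊆S y∈Y , col-x≢col-y
  ... | inj₂ col-x′≢col-y = x′ , y , X⊆S x′∈X , Y⊆S y∈Y , col-x′≢col-y

  module _ (G-irrefl : Irreflexive _≡_ G) where

    BicliqueParts-extend : ∀ {S X Y c} → c ∉ S → (∀ x → x ∈ X → ¬ G c x) → (∀ y → y ∈ Y → G c y) →
      BicliqueParts G S X Y → BicliqueParts G (S ∪ ⁅ c ⁆) (X ∪ ⁅ c ⁆) Y
    BicliqueParts-extend {S} {X} {Y} {c} c∉S c≁X c~Y
      (cover , X⊆S , Y⊆S , disjoint , (x , x∈X) , inY , cross , indepX , indepY) =
      cover′ , X′⊆S′ , p⊆p∪q ⁅ c ⁆ ∘ Y⊆S , disjoint′ , (x , p⊆p∪q ⁅ c ⁆ x∈X) , inY ,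
      cross′ , indepX′ , indepY
      where
      cover′ : ∀ v → v ∈ S ∪ ⁅ c ⁆ → v ∈ X ∪ ⁅ c ⁆ ⊎ v ∈ Y
      cover′ v v∈S′ with ∈∪⁅⁆⁻ S v∈S′
      ... | inj₂ refl = inj₁ (q⊆p∪q X ⁅ c ⁆ (x∈⁅x⁆ c))
      ... | inj₁ v∈S  = Sum.map₁ (p⊆p∪q ⁅ c ⁆) (cover v v∈S)
      X′⊆S′ : X ∪ ⁅ c ⁆ ⊆ S ∪ ⁅ c ⁆
      X′⊆S′ v∈X′ with ∈∪⁅⁆⁻ X v∈X′
      ... | inj₁ v∈X  = p⊆p∪q ⁅ c ⁆ (X⊆S v∈X)
      ... | inj₂ refl = q⊆p∪q S ⁅ c ⁆ (x∈⁅x⁆ c)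
      disjoint′ : ∀ v → v ∈ X ∪ ⁅ c ⁆ → v ∉ Y
      disjoint′ v v∈X′ v∈Y with ∈∪⁅⁆⁻ X v∈X′
      ... | inj₁ v∈X  = disjoint v v∈X v∈Y
      ... | inj₂ refl = c∉S (Y⊆S v∈Y)
      cross′ : ∀ u v → u ∈ X ∪ ⁅ c ⁆ → v ∈ Y → G u v
      cross′ u v u∈X′ v∈Y with ∈∪⁅⁆⁻ X u∈X′
      ... | inj₁ u∈X  = cross u v u∈X v∈Y
      ... | inj₂ refl = c~Y v v∈Y
      indepX′ : ∀ u v → u ∈ X ∪ ⁅ c ⁆ → v ∈ X ∪ ⁅ c ⁆ → ¬ G u v
      indepX′ u v u∈X′ v∈X′ with ∈∪⁅⁆⁻ X u∈X′ | ∈∪⁅⁆⁻ X v∈X′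
      ... | inj₁ u∈X  | inj₁ v∈X  = indepX u v u∈X v∈X
      ... | inj₁ u∈X  | inj₂ refl = c≁X u u∈X ∘ G-sym
      ... | inj₂ refl | inj₁ v∈X  = c≁X v v∈X
      ... | inj₂ refl | inj₂ refl = G-irrefl refl

    -- The distinguishing vertex c can be added to the side of x.
    singleEdge-¬biclique : ∀ {S X Y x y c} → BicliqueParts G S X Y → X ⊆ ⁅ x ⁆ → Y ⊆ ⁅ y ⁆ →
      Distinguishes G c y x → ¬ IsBiclique G S
    singleEdge-¬biclique {S} {X} {Y} {x} {y} {c} parts@(cover , _) X⊆x Y⊆y (c~y , c≁x , c≢x)
      (_ , maximal) =
      c∉S (maximal (S ∪ ⁅ c ⁆) (p⊆p∪q ⁅ c ⁆) (X ∪ ⁅ c ⁆ , Y , parts′) (q⊆p∪q S ⁅ c ⁆ (x∈⁅x⁆ c)))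
      where
      c∉S : c ∉ S
      c∉S c∈S with cover c c∈S
      ... | inj₁ c∈X = c≢x (x∈⁅y⁆⇒x≡y x (X⊆x c∈X))
      ... | inj₂ c∈Y with x∈⁅y⁆⇒x≡y y (Y⊆y c∈Y)
      ...   | refl = G-irrefl refl c~y
      parts′ : BicliqueParts G (S ∪ ⁅ c ⁆) (X ∪ ⁅ c ⁆) Y
      parts′ = BicliqueParts-extend c∉S
        (λ v v∈X → case x∈⁅y⁆⇒x≡y x (X⊆x v∈X) of λ { refl → c≁x })
        (λ v v∈Y → case x∈⁅y⁆⇒x≡y y (Y⊆y v∈Y) of λ { refl → c~y })
        parts

    noMonochromaticInducedP₃⇒bicliqueColouring : ∀ {c} {col : Fin n → Fin c} →
      EdgesDistinguished G → NoMonochromaticInducedP₃ G col → IsBicliqueColouring G c col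
    noMonochromaticInducedP₃⇒bicliqueColouring distinguished noMono S
      biclique@((X , Y , parts@(_ , _ , _ , _ , (x , x∈X) , (y , y∈Y) , cross , _)) , _)
      with otherMember⊎⊆⁅⁆ X x | otherMember⊎⊆⁅⁆ Y y
    ... | inj₁ (x′ , x′∈X , x′≢x) | _ = inducedP₃⇒bichromatic noMono parts x∈X x′∈X (≢-sym x′≢x) y∈Y
    ... | inj₂ _ | inj₁ (y′ , y′∈Y , y′≢y) =
      inducedP₃⇒bichromatic noMono (BicliqueParts-swap parts) y∈Y y′∈Y (≢-sym y′≢y) x∈X
    ... | inj₂ X⊆x | inj₂ Y⊆y with distinguished (cross x y x∈X y∈Y)
    ...   | _ , inj₁ near-x =
      ⊥-elim (singleEdge-¬biclique (BicliqueParts-swap parts) Y⊆y X⊆x near-x biclique)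
    ...   | _ , inj₂ near-y = ⊥-elim (singleEdge-¬biclique parts X⊆x Y⊆y near-y biclique)

    inducedP₃-isBiclique : ∀ {x y z} → G x y → G y z → ¬ G x z →
      (∀ v → G v x → G v z → ¬ G v y → v ≡ y) →
      (∀ v → G v y → ¬ G v x → ¬ G v z → v ≡ x ⊎ v ≡ z) →
      IsBiclique G ((⁅ x ⁆ ∪ ⁅ z ⁆) ∪ ⁅ y ⁆)
    inducedP₃-isBiclique {x} {y} {z} x~y y~z x≁z onlyCommonNeighbour onlyOtherNeighbours =
      (⁅ x ⁆ ∪ ⁅ z ⁆ , ⁅ y ⁆ , parts) , maximal
      where
      X Y S : Subset n
      X = ⁅ x ⁆ ∪ ⁅ z ⁆
      Y = ⁅ y ⁆
      S = X ∪ Y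
      x∈S : x ∈ S
      x∈S = p⊆p∪q Y (p⊆p∪q ⁅ z ⁆ (x∈⁅x⁆ x))
      y∈S : y ∈ S
      y∈S = q⊆p∪q X Y (x∈⁅x⁆ y)
      z∈S : z ∈ S
      z∈S = p⊆p∪q Y (q⊆p∪q ⁅ x ⁆ ⁅ z ⁆ (x∈⁅x⁆ z))
      X-adj-y : ∀ v → v ∈ X → G v y
      X-adj-y v v∈X with ∈⁅⁆∪⁅⁆⁻ v∈X
      ... | inj₁ refl = x~y
      ... | inj₂ refl = G-sym y~z
      parts : BicliqueParts G S X Y
      parts = (λ v → x∈p∪q⁻ X Y) , p⊆p∪q Y , q⊆p∪q X Y ,
        (λ v v∈X v∈Y → case x∈⁅y⁆⇒x≡y y v∈Y of λ { refl → G-irrefl refl (X-adj-y v v∈X) }) ,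
        (x , p⊆p∪q ⁅ z ⁆ (x∈⁅x⁆ x)) , (y , x∈⁅x⁆ y) ,
        (λ u v u∈X v∈Y → case x∈⁅y⁆⇒x≡y y v∈Y of λ { refl → X-adj-y u u∈X }) ,
        indepX ,
        (λ u v u∈Y v∈Y → case x∈⁅y⁆⇒x≡y y u∈Y , x∈⁅y⁆⇒x≡y y v∈Y of λ where
          (refl , refl) → G-irrefl refl)
        where
        indepX : ∀ u v → u ∈ X → v ∈ X → ¬ G u v
        indepX u v u∈X v∈X with ∈⁅⁆∪⁅⁆⁻ u∈X | ∈⁅⁆∪⁅⁆⁻ v∈X
        ... | inj₁ refl | inj₁ refl = G-irrefl refl
        ... | inj₁ refl | inj₂ refl = x≁z
        ... | inj₂ refl | inj₁ refl = x≁z ∘ G-sym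
        ... | inj₂ refl | inj₂ refl = G-irrefl refl
      -- Up to swapping the parts of T, x ∈ P; then y ∈ Q and z ∈ P, which pin down both parts.
      ⊆S : ∀ {T P Q} → BicliqueParts G T P Q → x ∈ P → S ⊆ T → T ⊆ S
      ⊆S (cover , _ , _ , _ , _ , _ , cross , indepP , _) x∈P S⊆T {v} v∈T
        with cover y (S⊆T y∈S) | cover z (S⊆T z∈S) | cover v v∈T
      ... | inj₁ y∈P | _ | _ = ⊥-elim (indepP x y x∈P y∈P x~y)
      ... | inj₂ _ | inj₂ z∈Q | _ = ⊥-elim (x≁z (cross x z x∈P z∈Q))
      ... | inj₂ y∈Q | inj₁ z∈P | inj₁ v∈P with onlyOtherNeighbours v (cross v y v∈P y∈Q)
                                                   (indepP v x v∈P x∈P) (indepP v z v∈P z∈P)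
      ...   | inj₁ refl = x∈S
      ...   | inj₂ refl = z∈S
      ⊆S (cover , _ , _ , _ , _ , _ , cross , _ , indepQ) x∈P S⊆T {v} v∈T
          | inj₂ y∈Q | inj₁ z∈P | inj₂ v∈Q
        with onlyCommonNeighbour v (G-sym (cross x v x∈P v∈Q)) (G-sym (cross z v z∈P v∈Q))
                                   (indepQ v y v∈Q y∈Q)
      ...   | refl = y∈S
      maximal : ∀ T → S ⊆ T → InducesBiclique G T → T ⊆ S
      maximal T S⊆T (P , Q , partsT@(cover , _)) with cover x (S⊆T x∈S)
      ... | inj₁ x∈P = ⊆S partsT x∈P S⊆T
      ... | inj₂ x∈Q = ⊆S (BicliqueParts-swap partsT) x∈Q S⊆T

biclique⇒¬colourable-<2 : ∀ {n c} {G : Graph n} {S} →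
  IsBiclique G S → c < 2 → ¬ BicliqueColourable G c
biclique⇒¬colourable-<2 ((_ , _ , _ , _ , _ , _ , (x , _) , _) , _) (s≤s z≤n) (col , _) with col x
... | ()
biclique⇒¬colourable-<2 {c = 1} biclique _ (col , isColouring) with isColouring _ biclique
... | u , v , _ , _ , col-u≢col-v with col u | col v
...   | Fin.zero | Fin.zero = col-u≢col-v refl

-- PathPower n k is, definitionally, Adjacent k on toℕ.
Adjacent : ℕ → ℕ → ℕ → Set
Adjacent k a b = (0 < ∣ a - b ∣) × (∣ a - b ∣ ≤ k)

module _ {k : ℕ} where

  <⇒adjacent : ∀ {a b} → a < b → b ≤ a + k → Adjacent k a b
  <⇒adjacent {a} {b} a<b b≤a+k rewrite m≤n⇒∣m-n∣≡n∸m (<⇒≤ a<b) =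
    m<n⇒0<n∸m a<b , m≤n+o⇒m∸n≤o b a b≤a+k

  adjacent-sym : ∀ {a b} → Adjacent k a b → Adjacent k b a
  adjacent-sym {a} {b} rewrite ∣-∣-comm a b = λ a~b → a~b

  adjacent⇒≤+ : ∀ {a b} → Adjacent k a b → a ≤ b + k
  adjacent⇒≤+ {a} {b} (_ , d≤k) = ≤-trans (m≤n+∣m-n∣ a b) (+-monoʳ-≤ b d≤k)

  adjacent-irrefl : ∀ {a} → ¬ Adjacent k a a
  adjacent-irrefl {a} (0<d , _) rewrite ∣n-n∣≡0 a = <-irrefl refl 0<d

  +<⇒¬adjacent : ∀ {a b} → a + k < b → ¬ Adjacent k a b
  +<⇒¬adjacent {a} {b} a+k<b a~b = <⇒≱ a+k<b (adjacent⇒≤+ {b} (adjacent-sym {a} a~b))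

  distinguishes : ∀ {c x y} → Adjacent k c x → c + k < y ⊎ y + k < c →
    Distinguishes (Adjacent k) c x y
  distinguishes {c} c~x (inj₁ c+k<y) =
    c~x , +<⇒¬adjacent c+k<y , <⇒≢ (m+n≤o⇒m≤o (suc c) c+k<y)
  distinguishes {c} {y = y} c~x (inj₂ y+k<c) =
    c~x , (λ c~y → +<⇒¬adjacent y+k<c (adjacent-sym {a = c} c~y)) , >⇒≢ (m+n≤o⇒m≤o (suc y) y+k<c)

  distinguishes-above : ∀ {a b} → a < b → b ≤ a + k → Distinguishes (Adjacent k) (suc (a + k)) b a
  distinguishes-above {a} {b} a<b b≤a+k =
    distinguishes {x = b} (adjacent-sym {a = b} (<⇒adjacent (s≤s b≤a+k) (+-monoˡ-≤ k a<b)))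
      (inj₂ ≤-refl)

  distinguishes-below : ∀ {a c} → a < suc (k + c) → suc (k + c) ≤ a + k →
    Distinguishes (Adjacent k) c a (suc (k + c))
  distinguishes-below {a} {c} a<b b≤a+k =
    distinguishes (<⇒adjacent c<a a≤c+k) (inj₁ (s≤s (≤-reflexive (+-comm c k))))
    where
    c<a : c < a
    c<a = +-cancelʳ-≤ k (suc c) a (subst (_≤ a + k) (cong suc (+-comm k c)) b≤a+k)
    a≤c+k : a ≤ c + k
    a≤c+k = subst (a ≤_) (+-comm k c) (s≤s⁻¹ a<b)

  -- If a + k + 1 ≥ n, then n ≥ 2k + 1 forces a ≥ k, so that b - k - 1 exists.
  distinguishingVertex-< : ∀ {n a b} → k + k < n → a < b → b ≤ a + k → b < n →
    ∃[ c ] c < n × (Distinguishes (Adjacent k) c a b ⊎ Distinguishes (Adjacent k) c b a)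
  distinguishingVertex-< {n} {a} {b} 2k<n a<b b≤a+k b<n with suc (a + k) <? n
  ... | yes 1+a+k<n = suc (a + k) , 1+a+k<n , inj₂ (distinguishes-above a<b b≤a+k)
  ... | no 1+a+k≮n with m≤n⇒∃[o]m+o≡n (≤-trans (s≤s k≤a) a<b)
    where
    k≤a : k ≤ a
    k≤a = +-cancelʳ-≤ k k a (s≤s⁻¹ (≤-trans 2k<n (≮⇒≥ 1+a+k≮n)))
  ...   | c , refl = c , <-trans (s≤s (m≤n+m c k)) b<n , inj₁ (distinguishes-below a<b b≤a+k)

  ≤∧¬adjacent⇒≡ : ∀ {t} → t ≤ k → ¬ Adjacent k t k → t ≡ k
  ≤∧¬adjacent⇒≡ {t} t≤k t≁k with m≤n⇒m<n∨m≡n t≤k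
  ... | inj₁ t<k = ⊥-elim (t≁k (<⇒adjacent t<k (m≤n+m k t)))
  ... | inj₂ t≡k = t≡k

  adjacent-k⇒≡0⊎≡1+k : ∀ {t} → Adjacent k t k → ¬ Adjacent k t 0 → ¬ Adjacent k t (suc k) →
    t ≡ 0 ⊎ t ≡ suc k
  adjacent-k⇒≡0⊎≡1+k {t} t~k t≁0 t≁1+k with t ≟ 0 | t ≟ suc k
  ... | yes t≡0 | _         = inj₁ t≡0
  ... | no _    | yes t≡1+k = inj₂ t≡1+k
  ... | no t≢0  | no t≢1+k  =
    ⊥-elim (t≁1+k (adjacent-sym {a = suc k} {b = t} (<⇒adjacent 1+k<t t≤1+k+k)))
    where
    k<t : k < t
    k<t with t ≤? k
    ... | yes t≤k = ⊥-elim (t≁0 (adjacent-sym {a = 0} {b = t} (<⇒adjacent (n≢0⇒n>0 t≢0) t≤k)))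
    ... | no t≰k  = ≰⇒> t≰k
    1+k<t : suc k < t
    1+k<t = ≤∧≢⇒< k<t (≢-sym t≢1+k)
    t≤1+k+k : t ≤ suc k + k
    t≤1+k+k = m≤n⇒m≤1+n (adjacent⇒≤+ t~k)

  distinguishingVertex : ∀ {n a b} → k + k < n → a < n → b < n → Adjacent k a b →
    ∃[ c ] c < n × (Distinguishes (Adjacent k) c a b ⊎ Distinguishes (Adjacent k) c b a)
  distinguishingVertex {a = a} {b} 2k<n a<n b<n a~b with <-cmp a b
  ... | tri< a<b _ _ =
    distinguishingVertex-< 2k<n a<b (adjacent⇒≤+ {a = b} (adjacent-sym {a = a} a~b)) b<n
  ... | tri≈ _ refl _ = ⊥-elim (adjacent-irrefl {a = a} a~b)
  ... | tri> _ _ b<a =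
    map₂ (map₂ Sum.swap) (distinguishingVertex-< 2k<n b<a (adjacent⇒≤+ a~b) a<n)

parityFin : ℕ → Fin 2
parityFin zero          = Fin.zero
parityFin (suc zero)    = Fin.suc Fin.zero
parityFin (suc (suc m)) = parityFin m

parityFin-suc : ∀ m → parityFin m ≢ parityFin (suc m)
parityFin-suc zero          ()
parityFin-suc (suc zero)    ()
parityFin-suc (suc (suc m)) = parityFin-suc m

consecutive : ∀ {x y z} → suc x ≤ z → z ≤ suc y → y ≤ suc x → y ≡ suc x ⊎ z ≡ suc y
consecutive {x} {y} {z} x<z z≤1+y y≤1+x with m≤n⇒m<n∨m≡n y≤1+x
... | inj₂ y≡1+x = inj₁ y≡1+x
... | inj₁ y<1+x = inj₂ (≤-antisym z≤1+y (≤-trans (s≤s (s≤s⁻¹ y<1+x)) x<z))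

module BlockColouring (k : ℕ) .{{_ : NonZero k}} where

  block : ℕ → ℕ
  block a = a / k

  block-+ : ∀ a → block (a + k) ≡ suc (block a)
  block-+ a = begin
    (a + k) / k     ≡⟨ +-distrib-/-∣ʳ a ∣-refl ⟩
    a / k + k / k   ≡⟨ cong (a / k +_) (n/n≡1 k) ⟩
    a / k + 1       ≡⟨ +-comm (a / k) 1 ⟩
    suc (a / k)     ∎
    where open ≡-Reasoning

  block-≤+ : ∀ {a b} → a ≤ b + k → block a ≤ suc (block b)
  block-≤+ {a} {b} a≤b+k = subst (block a ≤_) (block-+ b) (/-monoˡ-≤ k a≤b+k)

  blockColour : ℕ → Fin 2
  blockColour a = parityFin (block a)

  -- An edge advances at most one block and the non-edge a < c at least one, so one of
  -- the two edges of the path advances exactly one block.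
  blockColour-inducedP₃ : ∀ {a b c} → a < c → Adjacent k a b → Adjacent k b c → ¬ Adjacent k a c →
    blockColour a ≢ blockColour b ⊎ blockColour c ≢ blockColour b
  blockColour-inducedP₃ {a} {b} {c} a<c a~b b~c a≁c
    with consecutive a<c-block (block-≤+ (adjacent⇒≤+ {a = c} (adjacent-sym {a = b} b~c)))
                               (block-≤+ (adjacent⇒≤+ {a = b} (adjacent-sym {a = a} a~b)))
    where
    a+k<c : a + k < c
    a+k<c with c ≤? a + k
    ... | yes c≤a+k = ⊥-elim (a≁c (<⇒adjacent a<c c≤a+k))
    ... | no c≰a+k  = ≰⇒> c≰a+k
    a<c-block : suc (block a) ≤ block c
    a<c-block = subst (_≤ block c) (block-+ a) (/-monoˡ-≤ k (<⇒≤ a+k<c))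
  ... | inj₁ b≡1+a = inj₁ λ eq → parityFin-suc (block a) (trans eq (cong parityFin b≡1+a))
  ... | inj₂ c≡1+b = inj₂ λ eq → parityFin-suc (block b) (trans (sym eq) (cong parityFin c≡1+b))

  blockColour-noMonochromaticInducedP₃ : NoMonochromaticInducedP₃ (Adjacent k) blockColour
  blockColour-noMonochromaticInducedP₃ {a} {b} {c} a~b b~c a≁c a≢c with <-cmp a c
  ... | tri< a<c _ _ = blockColour-inducedP₃ a<c a~b b~c a≁c
  ... | tri≈ _ a≡c _ = ⊥-elim (a≢c a≡c)
  ... | tri> _ _ c<a = Sum.swap (blockColour-inducedP₃ c<a (adjacent-sym {a = b} b~c)
                         (adjacent-sym {a = a} a~b) (a≁c ∘ adjacent-sym {a = c}))

module PathPowerGraph (n k : ℕ) .{{_ : NonZero k}} (k+k<n : k + k < n) where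
  open BlockColouring k

  G : Graph n
  G = PathPower n k

  G-sym : Symmetric G
  G-sym {i} {j} = adjacent-sym {a = toℕ i} {b = toℕ j}

  G-irrefl : Irreflexive _≡_ G
  G-irrefl {i} refl = adjacent-irrefl {a = toℕ i}

  G-edgesDistinguished : EdgesDistinguished G
  G-edgesDistinguished {i} {j} i~j with distinguishingVertex k+k<n (toℕ<n i) (toℕ<n j) i~j
  ... | c , c<n , distinguishes = fromℕ< c<n , Sum.map lift lift distinguishes
    where
    lift : ∀ {x y} → Distinguishes (Adjacent k) c (toℕ x) (toℕ y) → Distinguishes G (fromℕ< c<n) x y
    lift {x} {y} = Distinguishes-on {R = Adjacent k} {f = toℕ} toℕ-injective
                 ∘ subst (λ m → Distinguishes (Adjacent k) m (toℕ x) (toℕ y)) (sym (toℕ-fromℕ< c<n))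

  -- The symmetry proof is η-expanded below because G, not being injective, does not
  -- determine the implicit endpoints.
  blockColouring : IsBicliqueColouring G 2 (blockColour ∘ toℕ)
  blockColouring =
    noMonochromaticInducedP₃⇒bicliqueColouring {G = G} (λ {i} {j} → G-sym {i} {j}) G-irrefl
      G-edgesDistinguished
      (NoMonochromaticInducedP₃-on {R = Adjacent k} {f = toℕ} toℕ-injective
        blockColour-noMonochromaticInducedP₃)

  0<n : 0 < n
  0<n = <-≤-trans z<s k+k<n
  1+k<n : suc k < n
  1+k<n = <-≤-trans (s≤s (+-monoˡ-≤ k (>-nonZero⁻¹ k))) k+k<n
  k<n : k < n
  k<n = <-trans (n<1+n k) 1+k<n

  x y z : Fin n
  x = fromℕ< 0<n
  y = fromℕ< k<n
  z = fromℕ< 1+k<n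

  x~y : G x y
  x~y rewrite toℕ-fromℕ< 0<n | toℕ-fromℕ< k<n = <⇒adjacent (>-nonZero⁻¹ k) ≤-refl

  y~z : G y z
  y~z rewrite toℕ-fromℕ< k<n | toℕ-fromℕ< 1+k<n = <⇒adjacent ≤-refl (+-monoˡ-≤ k (>-nonZero⁻¹ k))

  x≁z : ¬ G x z
  x≁z rewrite toℕ-fromℕ< 0<n | toℕ-fromℕ< 1+k<n = +<⇒¬adjacent {a = 0} ≤-refl

  onlyCommonNeighbour : ∀ v → G v x → G v z → ¬ G v y → v ≡ y
  onlyCommonNeighbour v rewrite toℕ-fromℕ< 0<n | toℕ-fromℕ< k<n = λ v~x _ v≁y →
    toℕ-injective (trans (≤∧¬adjacent⇒≡ (adjacent⇒≤+ v~x) v≁y) (sym (toℕ-fromℕ< k<n)))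

  onlyOtherNeighbours : ∀ v → G v y → ¬ G v x → ¬ G v z → v ≡ x ⊎ v ≡ z
  onlyOtherNeighbours v rewrite toℕ-fromℕ< 0<n | toℕ-fromℕ< k<n | toℕ-fromℕ< 1+k<n = λ v~y v≁x v≁z →
    Sum.map (λ v≡0 → toℕ-injective (trans v≡0 (sym (toℕ-fromℕ< 0<n))))
            (λ v≡1+k → toℕ-injective (trans v≡1+k (sym (toℕ-fromℕ< 1+k<n))))
            (adjacent-k⇒≡0⊎≡1+k v~y v≁x v≁z)

  inducedP₃-biclique : IsBiclique G ((⁅ x ⁆ ∪ ⁅ z ⁆) ∪ ⁅ y ⁆)
  inducedP₃-biclique = inducedP₃-isBiclique {G = G} (λ {i} {j} → G-sym {i} {j}) G-irrefl {x} {y} {z}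
    x~y y~z x≁z onlyCommonNeighbour onlyOtherNeighbours

  bicliqueChromaticNumber≡2 : BicliqueChromaticNumber≡ G 2
  bicliqueChromaticNumber≡2 =
    (blockColour ∘ toℕ , blockColouring) , λ _ → biclique⇒¬colourable-<2 {G = G} inducedP₃-biclique

theorem3 : (k n : ℕ) → 1 ≤ k → 2 * k + 1 ≤ n →
    BicliqueChromaticNumber≡ (PathPower n k) 2
theorem3 k@(suc _) n _ 2k+1≤n = PathPowerGraph.bicliqueChromaticNumber≡2 n k k+k<n
  where
  k+k<n : k + k < n
  k+k<n = subst (_≤ n) (trans (+-comm (2 * k) 1) (cong (λ m → suc (k + m)) (+-identityʳ k))) 2k+1≤n
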